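{- Let $L$ be a bounded regular language. There exist integers $n, k \geq 0$ and a finite set $P$ of Lyndon words such that: (1) if $p, q \in P$, $p \neq q$, and $l, m \geq 0$, then $p^l$ and $q^m$ do not have a common factor of length $n$; (2) if $u \in L$ and $p \in P$, then either there is at most one maximal $p^{\geq n}$-occurrence in $u$, or $L$ has a subset of the form $x (p^m)^* y (p^m)^* z$ for some words $x, y, z$ and some $m \geq 1$ with $py \neq yp$; (3) if $u \in L$ and $x$ is a factor of $u$ of length at least $k$, then $x$ has a factor $p^{n+1}$ for some $p \in P$.
   Context: A language $L$ is bounded if $L \subseteq v_1^* \cdots v_n^*$ for some words $v_1, \dots, v_n$. The alphabet is totally ordered; a Lyndon word is a primitive word (not a power of a shorter word) that is lexicographically smaller than all its other conjugates. An occurrence of $u$ in $w$ is a triple $(x,u,y)$ with $w = xuy$; for a language $M$, an $M$-occurrence is an occurrence with $u \in M$. $(x,u,y)$ is contained in $(x',u',y')$ if $|x| \geq |x'|$ and $|y| \geq |y'|$; an $M$-occurrence in $w$ is maximal if it is not contained in any other $M$-occurrence in $w$. Here $p^{\geq n} = \{p^i : i \geq n\}$. -}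

module Defs where

open import Data.Nat using (ℕ; zero; suc; _≤_; _≥_)
open import Data.Fin using (Fin)
import Data.Fin as Fin
open import Data.Bool using (Bool; true)
open import Data.List using (List; []; _∷_; _++_; length)
open import Data.List.Membership.Propositional using (_∈_)
open import Data.Product using (Σ; ∃; _×_; _,_)
open import Data.Sum using (_⊎_)
open import Relation.Nullary using (¬_)
open import Relation.Binary.PropositionalEquality using (_≡_; _≢_)

-- Words over the finite totally ordered alphabet Fin s (order: Fin._<_)
Word : ℕ → Set
Word s = List (Fin s)

Language : ℕ → Set₁
Language s = Word s → Set

_^_ : ∀ {s} → Word s → ℕ → Word s
w ^ zero  = []
w ^ suc i = w ++ (w ^ i)

record DFA (s : ℕ) : Set where
  field
    nStates : ℕ
    start   : Fin nStates
    δ       : Fin nStates → Fin s → Fin nStates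
    final   : Fin nStates → Bool

run : ∀ {s} (D : DFA s) → Fin (DFA.nStates D) → Word s → Fin (DFA.nStates D)
run D q []       = q
run D q (a ∷ w)  = run D (DFA.δ D q a) w

Accepts : ∀ {s} → DFA s → Word s → Set
Accepts D w = DFA.final D (run D (DFA.start D) w) ≡ true

Regular : ∀ {s} → Language s → Set
Regular {s} L = Σ (DFA s) λ D → ∀ w → (L w → Accepts D w) × (Accepts D w → L w)

-- Bounded languages: L ⊆ v₁* ⋯ vₙ*

InStarProduct : ∀ {s} → List (Word s) → Word s → Set
InStarProduct []       w = w ≡ []
InStarProduct (v ∷ vs) w = Σ ℕ λ i → Σ (Word _) λ w' → (w ≡ (v ^ i) ++ w') × InStarProduct vs w'

Bounded : ∀ {s} → Language s → Set
Bounded {s} L = Σ (List (Word s)) λ vs → ∀ w → L w → InStarProduct vs w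

data _<lex_ {s : ℕ} : Word s → Word s → Set where
  []<∷ : ∀ {b bs} → [] <lex (b ∷ bs)
  here : ∀ {a b as bs} → a Fin.< b → (a ∷ as) <lex (b ∷ bs)
  there : ∀ {a as bs} → as <lex bs → (a ∷ as) <lex (a ∷ bs)

-- primitive: not a power u^k of a word u with k ≥ 2
-- (in particular the empty word, = []^2, is not primitive)
Primitive : ∀ {s} → Word s → Set
Primitive {s} w = ¬ (Σ (Word s) λ u → Σ ℕ λ k → (k ≥ 2) × (w ≡ u ^ k))

Lyndon : ∀ {s} → Word s → Set
Lyndon {s} w = Primitive w ×
  (∀ (x y : Word s) → x ≢ [] → y ≢ [] → w ≡ x ++ y → w <lex (y ++ x))

Factor : ∀ {s} → Word s → Word s → Set
Factor {s} x u = Σ (Word s) λ a → Σ (Word s) λ b → u ≡ a ++ x ++ b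

Occurrence : ∀ {s} → Set
Occurrence {s} = Word s × Word s × Word s

IsOcc : ∀ {s} → Word s → Occurrence {s} → Set
IsOcc w (x , u , y) = w ≡ x ++ u ++ y

IsMOcc : ∀ {s} → Language s → Word s → Occurrence {s} → Set
IsMOcc M w (x , u , y) = IsOcc w (x , u , y) × M u

ContainedIn : ∀ {s} → Occurrence {s} → Occurrence {s} → Set
ContainedIn (x , u , y) (x' , u' , y') = (length x ≥ length x') × (length y ≥ length y')

IsMaximalMOcc : ∀ {s} → Language s → Word s → Occurrence {s} → Set
IsMaximalMOcc {s} M w o = IsMOcc M w o ×
  (∀ (o' : Occurrence {s}) → IsMOcc M w o' → ContainedIn o o' → o' ≡ o)

PowAtLeast : ∀ {s} → Word s → ℕ → Language s
PowAtLeast {s} p n u = Σ ℕ λ i → (i ≥ n) × (u ≡ p ^ i)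

AtMostOneMaximal : ∀ {s} → Language s → Word s → Set
AtMostOneMaximal {s} M w = ∀ (o₁ o₂ : Occurrence {s}) →
  IsMaximalMOcc M w o₁ → IsMaximalMOcc M w o₂ → o₁ ≡ o₂

NoCommonFactors : ∀ {s} → ℕ → List (Word s) → Set
NoCommonFactors {s} n P = ∀ p q → p ∈ P → q ∈ P → p ≢ q → ∀ (l m : ℕ) →
  ¬ (Σ (Word s) λ w → (length w ≡ n) × Factor w (p ^ l) × Factor w (q ^ m))

HasPumpingSubset : ∀ {s} → Language s → Word s → Set
HasPumpingSubset {s} L p = Σ (Word s) λ x → Σ (Word s) λ y → Σ (Word s) λ z → Σ ℕ λ m →
  (m ≥ 1) × ((p ++ y) ≢ (y ++ p)) ×
  (∀ (i j : ℕ) → L (x ++ ((p ^ m) ^ i) ++ y ++ ((p ^ m) ^ j) ++ z))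

Condition2 : ∀ {s} → Language s → ℕ → List (Word s) → Set
Condition2 L n P = ∀ u p → L u → p ∈ P →
  AtMostOneMaximal (PowAtLeast p n) u ⊎ HasPumpingSubset L p

Condition3 : ∀ {s} → Language s → ℕ → ℕ → List (Word s) → Set
Condition3 {s} L n k P = ∀ u x → L u → Factor x u → length x ≥ k →
  Σ (Word s) λ p → (p ∈ P) × Factor (p ^ suc n) x

module Submission where

-- Let L ⊆ v₁* ⋯ vₘ* be recognised by an automaton with N states.  For P we take
-- the Lyndon roots of the nonempty vᵢ: vᵢ = rᵉ with r primitive, and the least
-- rotation p of r is a Lyndon word.
--  (1) If powers of Lyndon words p, q share a factor w with |w| ≥ |p| + |q|, then w
--      is a prefix of powers of conjugates p′, q′ of p, q; a weak Fine–Wilf argument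
--      makes p′, q′ commute, hence coincide, and conjugate Lyndon words are equal.
--  (3) A long factor of v₁^i₁ ⋯ vₘ^iₘ has a long factor inside one block vᵢ^iᵢ, and
--      a factor of a power of vᵢ of length ≥ (n+2)|vᵢ| contains pⁿ⁺¹.
--  (2) For n ≥ 2N, two distinct maximal p^{≥n}-occurrences in an accepted word give,
--      by pigeonhole, a loop pᵈ¹ in the first run and a loop pᵈ² in the second; they
--      pump to x (pᵐ)* y (pᵐ)* z ⊆ L, and py ≠ yp since otherwise a single run of p
--      would cover both maximal occurrences.  A word has finitely many occurrences,
--      so maximality is decidable and one of the two alternatives can be chosen.

open import Defs
open import Data.Nat using (ℕ)
open import Data.List using (List)
open import Data.List.Relation.Unary.All using (All)
open import Data.Product using (Σ; _×_)

open import Data.Nat using (zero; suc; _+_; _*_; _∸_; _≤_; _<_; _≥_; z≤n; s≤s; s≤s⁻¹; _≤?_; >-nonZero)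
open import Data.Nat.Properties
open import Data.Nat.ListAction using (sum)
open import Data.Fin using (Fin; toℕ)
import Data.Fin.Properties as Fin
open import Data.List using ([]; _∷_; _++_; length; take; drop; applyUpTo; map; concatMap)
open import Data.List.Properties
  using (++-assoc; ++-identityʳ; length-++; length-++-≤ˡ; ++-monoid; ∷-injective; ++-cancelˡ; ≡-dec; take++drop≡id)
open import Data.List.Membership.Propositional using (_∈_; lose)
open import Data.List.Membership.Propositional.Properties using (∈-applyUpTo⁺; ∈-applyUpTo⁻; ∈-map⁺; ∈-map⁻; ∈-concat⁺′)
import Data.List.Relation.Unary.All as All
open import Data.List.Relation.Unary.All using ([]; _∷_)
open import Data.List.Relation.Unary.Any as Any using (here; there)
open import Data.Product using (_,_; proj₁; proj₂)
import Data.Product.Properties as Product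
open import Data.Sum as Sum using (_⊎_; inj₁; inj₂)
open import Data.Empty using (⊥-elim)
open import Relation.Binary.Definitions using (tri<; tri≈; tri>; DecidableEquality)
open import Relation.Binary.PropositionalEquality
open import Relation.Nullary using (¬_; Dec; yes; no)
open import Relation.Nullary.Decidable using (map′; _×-dec_; _→-dec_; ¬?)
open import Algebra.Bundles using (Monoid)
open import Tactic.MonoidSolver using (solve)

private variable
  s : ℕ

words : (s : ℕ) → Monoid _ _
words s = ++-monoid (Fin s)

^-+ : (p : Word s) (a b : ℕ) → p ^ (a + b) ≡ p ^ a ++ p ^ b
^-+ p zero    b = refl
^-+ p (suc a) b = trans (cong (p ++_) (^-+ p a b)) (sym (++-assoc p (p ^ a) (p ^ b)))

^-* : (p : Word s) (a b : ℕ) → p ^ (a * b) ≡ (p ^ a) ^ b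
^-* p a zero    = cong (p ^_) (*-zeroʳ a)
^-* p a (suc b) = begin
  p ^ (a * suc b)           ≡⟨ cong (p ^_) (*-suc a b) ⟩
  p ^ (a + a * b)           ≡⟨ ^-+ p a (a * b) ⟩
  p ^ a ++ p ^ (a * b)      ≡⟨ cong (p ^ a ++_) (^-* p a b) ⟩
  p ^ a ++ (p ^ a) ^ b      ∎
  where open ≡-Reasoning

length-^ : (p : Word s) (i : ℕ) → length (p ^ i) ≡ i * length p
length-^ p zero    = refl
length-^ p (suc i) = trans (length-++ p) (cong (length p +_) (length-^ p i))

[]-^ : (i : ℕ) → [] ^ i ≡ [] {A = Fin s}
[]-^ zero    = refl
[]-^ (suc i) = []-^ i

power-split₃ : (p : Word s) (a b c : ℕ) → p ^ (a + (b + c)) ≡ p ^ a ++ p ^ b ++ p ^ c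
power-split₃ p a b c = trans (^-+ p a (b + c)) (cong (p ^ a ++_) (^-+ p b c))

power-split : (p : Word s) (a b : ℕ) {c : ℕ} → a + b ≤ c → p ^ c ≡ p ^ a ++ p ^ b ++ p ^ (c ∸ (a + b))
power-split p a b {c} le = trans (cong (p ^_) (sym c≡)) (power-split₃ p a b (c ∸ (a + b)))
  where
  c≡ : a + (b + (c ∸ (a + b))) ≡ c
  c≡ = trans (sym (+-assoc a b _)) (m+[n∸m]≡n le)

run-split : (p x y : Word s) {u : Word s} {c : ℕ} (a d : ℕ) → u ≡ x ++ p ^ c ++ y → a + d ≤ c →
  u ≡ (x ++ p ^ a) ++ p ^ d ++ p ^ (c ∸ (a + d)) ++ y
run-split {s} p x y {u} {c} a d u≡ le = begin
  u                                               ≡⟨ u≡ ⟩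
  x ++ p ^ c ++ y                                 ≡⟨ cong (λ t → x ++ t ++ y) (power-split p a d le) ⟩
  x ++ (p ^ a ++ p ^ d ++ p ^ (c ∸ (a + d))) ++ y ≡⟨ solve (words s) ⟩
  (x ++ p ^ a) ++ p ^ d ++ p ^ (c ∸ (a + d)) ++ y ∎
  where open ≡-Reasoning

length-power-mono : (x x′ p : Word s) {i j : ℕ} → length x ≤ length x′ → i ≤ j →
  length (x ++ p ^ i) ≤ length (x′ ++ p ^ j)
length-power-mono x x′ p {i} {j} x≤x′ i≤j =
  subst₂ _≤_ (sym (trans (length-++ x) (cong (length x +_) (length-^ p i))))
             (sym (trans (length-++ x′) (cong (length x′ +_) (length-^ p j))))
             (+-mono-≤ x≤x′ (*-monoˡ-≤ (length p) i≤j))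

power-shift : (a e : Word s) (l : ℕ) → (a ++ e) ^ l ++ a ≡ a ++ (e ++ a) ^ l
power-shift a e zero    = sym (++-identityʳ a)
power-shift {s} a e (suc l) = begin
  ((a ++ e) ++ (a ++ e) ^ l) ++ a   ≡⟨ solve (words s) ⟩
  (a ++ e) ++ ((a ++ e) ^ l ++ a)   ≡⟨ cong ((a ++ e) ++_) (power-shift a e l) ⟩
  (a ++ e) ++ (a ++ (e ++ a) ^ l)   ≡⟨ solve (words s) ⟩
  a ++ ((e ++ a) ++ (e ++ a) ^ l)   ∎
  where open ≡-Reasoning

levi : (a b c d : Word s) → a ++ b ≡ c ++ d →
  (Σ (Word s) λ e → (c ≡ a ++ e) × (b ≡ e ++ d)) ⊎
  (Σ (Word s) λ e → (a ≡ c ++ e) × (d ≡ e ++ b))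
levi []      b c       d eq = inj₁ (c , refl , eq)
levi (x ∷ a) b []      d eq = inj₂ (x ∷ a , refl , sym eq)
levi (x ∷ a) b (y ∷ c) d eq with ∷-injective eq
... | refl , eq′ with levi a b c d eq′
...   | inj₁ (e , c≡ , b≡) = inj₁ (e , cong (x ∷_) c≡ , b≡)
...   | inj₂ (e , a≡ , d≡) = inj₂ (e , cong (x ∷_) a≡ , d≡)

Prefix : Word s → Word s → Set
Prefix {s} a w = Σ (Word s) λ t → w ≡ a ++ t

prefix-trans : {a b c : Word s} → Prefix a b → Prefix b c → Prefix a c
prefix-trans {a = a} (t , b≡) (t′ , c≡) =
  t ++ t′ , trans c≡ (trans (cong (_++ t′) b≡) (++-assoc a t t′))

no-extension : (c e : Word s) → length (c ++ e) ≤ length c → e ≡ []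
no-extension c []      _  = refl
no-extension c (x ∷ e) le = ⊥-elim (m+1+n≰m (length c) (subst (_≤ length c) (length-++ c) le))

prefix-shorter : {a c w : Word s} → Prefix a w → Prefix c w → length a ≤ length c → Prefix a c
prefix-shorter {a = a} {c} (t , w≡at) (t′ , w≡ct′) le with levi a t c t′ (trans (sym w≡at) w≡ct′)
... | inj₁ (e , c≡ae , _) = e , c≡ae
... | inj₂ (e , a≡ce , _) = [] , trans (sym a≡c) (sym (++-identityʳ a))
  where
  e≡[] : e ≡ []
  e≡[] = no-extension c e (subst (λ z → length z ≤ length c) a≡ce le)
  a≡c : a ≡ c
  a≡c = trans a≡ce (trans (cong (c ++_) e≡[]) (++-identityʳ c))

prefix-equal : {a c : Word s} → Prefix a c → length c ≤ length a → a ≡ c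
prefix-equal {a = a} (t , c≡at) le =
  sym (trans c≡at (trans (cong (a ++_) t≡[]) (++-identityʳ a)))
  where
  t≡[] : t ≡ []
  t≡[] = no-extension a t (subst (λ z → length z ≤ length a) c≡at le)

factor-refl : (x : Word s) → Factor x x
factor-refl x = [] , [] , sym (++-identityʳ x)

prefix⇒factor : {a w : Word s} → Prefix a w → Factor a w
prefix⇒factor (t , w≡at) = [] , t , w≡at

suffix⇒factor : {a x w : Word s} → w ≡ a ++ x → Factor x w
suffix⇒factor {a = a} {x} w≡ = a , [] , trans w≡ (cong (a ++_) (sym (++-identityʳ x)))

factor-trans : {x y z : Word s} → Factor x y → Factor y z → Factor x z
factor-trans {s} {x} {y} {z} (a , b , y≡) (c , d , z≡) = c ++ a , b ++ d , (begin
  z                          ≡⟨ z≡ ⟩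
  c ++ y ++ d                ≡⟨ cong (λ t → c ++ t ++ d) y≡ ⟩
  c ++ (a ++ x ++ b) ++ d    ≡⟨ solve (words s) ⟩
  (c ++ a) ++ x ++ b ++ d    ∎)
  where open ≡-Reasoning

factor-length : {x y : Word s} → Factor x y → length x ≤ length y
factor-length {x = x} {y} (a , b , y≡) = begin
  length x                      ≤⟨ m≤n+m (length x) (length a) ⟩
  length a + length x           ≤⟨ m≤m+n _ (length b) ⟩
  length a + length x + length b ≡⟨ +-assoc (length a) _ _ ⟩
  length a + (length x + length b) ≡⟨ cong (length a +_) (sym (length-++ x)) ⟩
  length a + length (x ++ b)    ≡⟨ sym (length-++ a) ⟩
  length (a ++ x ++ b)          ≡⟨ cong length (sym y≡) ⟩
  length y                      ∎
  where open ≤-Reasoning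

Conj : Word s → Word s → Set
Conj {s} x y = Σ (Word s) λ a → Σ (Word s) λ b → (x ≡ a ++ b) × (y ≡ b ++ a)

conj-refl : (x : Word s) → Conj x x
conj-refl x = [] , x , refl , sym (++-identityʳ x)

conj-sym : {x y : Word s} → Conj x y → Conj y x
conj-sym (a , b , x≡ , y≡) = b , a , y≡ , x≡

conj-trans : {x y z : Word s} → Conj x y → Conj y z → Conj x z
conj-trans (a , b , x≡ab , y≡ba) (c , d , y≡cd , z≡dc) with levi b a c d (trans (sym y≡ba) y≡cd)
... | inj₁ (e , c≡be , a≡ed) = e , d ++ b ,
  trans x≡ab (trans (cong (_++ b) a≡ed) (++-assoc e d b)) ,
  trans z≡dc (trans (cong (d ++_) c≡be) (sym (++-assoc d b e)))
... | inj₂ (e , b≡ce , d≡ea) = a ++ c , e ,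
  trans x≡ab (trans (cong (a ++_) b≡ce) (sym (++-assoc a c e))) ,
  trans z≡dc (trans (cong (_++ c) d≡ea) (++-assoc e a c))

conj-length : {x y : Word s} → Conj x y → length x ≡ length y
conj-length {x = x} {y} (a , b , x≡ , y≡) = begin
  length x             ≡⟨ cong length x≡ ⟩
  length (a ++ b)      ≡⟨ length-++ a ⟩
  length a + length b  ≡⟨ +-comm (length a) _ ⟩
  length b + length a  ≡⟨ sym (length-++ b) ⟩
  length (b ++ a)      ≡⟨ cong length (sym y≡) ⟩
  length y             ∎
  where open ≡-Reasoning

PrefixOfPower : Word s → Word s → Set
PrefixOfPower p w = Σ ℕ λ J → Prefix w (p ^ J)

power-prefix : (p : Word s) {i j : ℕ} → i ≤ j → Prefix (p ^ i) (p ^ j)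
power-prefix p {i} {j} i≤j = p ^ (j ∸ i) , trans (cong (p ^_) (sym (m+[n∸m]≡n i≤j))) (^-+ p i (j ∸ i))

pp-power : (p : Word s) (i : ℕ) → PrefixOfPower p (p ^ i)
pp-power p i = i , [] , sym (++-identityʳ (p ^ i))

pp-prefix : {p a w : Word s} → Prefix a w → PrefixOfPower p w → PrefixOfPower p a
pp-prefix a≤w (J , w≤pᴶ) = J , prefix-trans a≤w w≤pᴶ

pp-compare : {p a b : Word s} → PrefixOfPower p a → PrefixOfPower p b → length a ≤ length b → Prefix a b
pp-compare {p = p} (J , a≤pᴶ) (K , b≤pᴷ) =
  prefix-shorter (prefix-trans a≤pᴶ (power-prefix p (m≤m+n J K)))
                 (prefix-trans b≤pᴷ (power-prefix p (m≤n+m K J)))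

pp-unique : {p a b : Word s} → PrefixOfPower p a → PrefixOfPower p b → length a ≡ length b → a ≡ b
pp-unique ppa ppb eq = prefix-equal (pp-compare ppa ppb (≤-reflexive eq)) (≤-reflexive (sym eq))

pp-drop : {p w : Word s} → 0 < length p → PrefixOfPower p (p ++ w) → PrefixOfPower p w
pp-drop {p = x ∷ p} _ (zero , t , ())
pp-drop {p = p} {w} _ (suc J , t , eq) = J , t , ++-cancelˡ p _ _ (trans eq (++-assoc p w t))

factor-of-power : (p : Word s) (l : ℕ) (A w B : Word s) → p ^ l ≡ A ++ w ++ B →
  Σ (Word s) λ p′ → Conj p′ p × PrefixOfPower p′ w
factor-of-power p zero    []      []      B eq = p , conj-refl p , 0 , [] , refl
factor-of-power p (suc l) A       w       B eq with levi p (p ^ l) A (w ++ B) eq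
... | inj₁ (e , A≡pe , pˡ≡ewB) = factor-of-power p l e w B pˡ≡ewB
factor-of-power {s} .(A ++ e) (suc l) A w B eq | inj₂ (e , refl , wB≡) =
  e ++ A , (e , A , refl , refl) , suc l , B ++ A , (begin
    (e ++ A) ++ (e ++ A) ^ l   ≡⟨ solve (words s) ⟩
    e ++ A ++ (e ++ A) ^ l     ≡⟨ cong (e ++_) (sym (power-shift A e l)) ⟩
    e ++ (A ++ e) ^ l ++ A     ≡⟨ solve (words s) ⟩
    (e ++ (A ++ e) ^ l) ++ A   ≡⟨ cong (_++ A) (sym wB≡) ⟩
    (w ++ B) ++ A              ≡⟨ ++-assoc w B A ⟩
    w ++ B ++ A                ∎)
  where open ≡-Reasoning

commuting-powers : (x y : Word s) → x ++ y ≡ y ++ x →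
  Σ (Word s) λ z → Σ ℕ λ i → Σ ℕ λ j → (x ≡ z ^ i) × (y ≡ z ^ j)
commuting-powers x y = go (length x + length y) x y ≤-refl
  where
  go : ∀ {s} (f : ℕ) (x y : Word s) → length x + length y ≤ f → x ++ y ≡ y ++ x →
    Σ (Word s) λ z → Σ ℕ λ i → Σ ℕ λ j → (x ≡ z ^ i) × (y ≡ z ^ j)
  go f []      y       _  _  = y , 0 , 1 , refl , sym (++-identityʳ y)
  go f (a ∷ x) []      _  _  = a ∷ x , 1 , 0 , sym (++-identityʳ (a ∷ x)) , refl
  go (suc f) (a ∷ x) (b ∷ y) le eq with levi (a ∷ x) (b ∷ y) (b ∷ y) (a ∷ x) eq
  ... | inj₁ (e , y≡xe , y≡ex) with go f (a ∷ x) e bound (trans (sym y≡xe) y≡ex)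
    where
    bound : length (a ∷ x) + length e ≤ f
    bound = subst (_≤ f) (trans (cong length y≡xe) (length-++ (a ∷ x))) (m+n≤o⇒n≤o (length x) (s≤s⁻¹ le))
  ...   | z , i , j , x≡ , e≡ = z , i , i + j , x≡ , trans y≡xe (trans (cong₂ _++_ x≡ e≡) (sym (^-+ z i j)))
  go (suc f) (a ∷ x) (b ∷ y) le eq | inj₂ (e , x≡ye , x≡ey) with go f (b ∷ y) e bound (trans (sym x≡ye) x≡ey)
    where
    bound : length (b ∷ y) + length e ≤ f
    bound = subst (_≤ f) (trans (cong length x≡ye) (length-++ (b ∷ y)))
                  (m+n≤o⇒n≤o (length y) (s≤s⁻¹ (subst (_≤ suc f) (+-comm (length (a ∷ x)) _) le)))
  ...   | z , i , j , y≡ , e≡ = z , i + j , i , trans x≡ye (trans (cong₂ _++_ y≡ e≡) (sym (^-+ z i j))) , y≡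

ProperPower : Word s → Set
ProperPower {s} w = Σ (Word s) λ u → Σ ℕ λ k → (k ≥ 2) × (w ≡ u ^ k)

[]-not-primitive : ¬ Primitive {s} []
[]-not-primitive prim = prim ([] , 2 , s≤s (s≤s z≤n) , refl)

primitive-nonempty : {w : Word s} → Primitive w → 0 < length w
primitive-nonempty {w = []}    prim = ⊥-elim ([]-not-primitive prim)
primitive-nonempty {w = _ ∷ _} prim = s≤s z≤n

commutes-with-primitive : {p y : Word s} → Primitive p → p ++ y ≡ y ++ p → Σ ℕ λ t → y ≡ p ^ t
commutes-with-primitive {p = p} {y} prim eq with commuting-powers p y eq
... | z , zero          , j , p≡ , y≡ = ⊥-elim ([]-not-primitive (subst Primitive p≡ prim))
... | z , suc zero      , j , p≡ , y≡ = j , trans y≡ (cong (_^ j) (sym (trans p≡ (++-identityʳ z))))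
... | z , suc (suc i)   , j , p≡ , y≡ = ⊥-elim (prim (z , suc (suc i) , s≤s (s≤s z≤n) , p≡))

primitive-commuting-equal : {p q : Word s} → Primitive p → Primitive q → p ++ q ≡ q ++ p → q ≡ p
primitive-commuting-equal {p = p} primp primq eq with commutes-with-primitive primp eq
... | zero          , q≡ = ⊥-elim ([]-not-primitive (subst Primitive q≡ primq))
... | suc zero      , q≡ = trans q≡ (++-identityʳ p)
... | suc (suc t)   , q≡ = ⊥-elim (primq (p , suc (suc t) , s≤s (s≤s z≤n) , q≡))

primitive-split : {c x y : Word s} → Primitive c → c ≡ x ++ y → x ≢ [] → y ≢ [] → x ++ y ≢ y ++ x
primitive-split {x = x} {y} prim c≡ x≢[] y≢[] eq with commuting-powers x y eq
... | z , zero  , j     , x≡ , y≡ = x≢[] x≡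
... | z , suc i , zero  , x≡ , y≡ = y≢[] y≡
... | z , suc i , suc j , x≡ , y≡ =
  prim (z , suc i + suc j , s≤s (subst (1 ≤_) (sym (+-suc i j)) (s≤s z≤n)) ,
        trans c≡ (trans (cong₂ _++_ x≡ y≡) (sym (^-+ z (suc i) (suc j)))))

-- Primitivity is invariant under conjugacy: a conjugate of uᵏ is u′ᵏ for a conjugate u′ of u.
conj-primitive : {w p : Word s} → Primitive p → Conj w p → Primitive w
conj-primitive {s} {w} {p} prim (a , b , w≡ab , p≡ba) (u , k , k≥2 , w≡uᵏ)
  with factor-of-power u (k + k) a p b (begin
    u ^ (k + k)         ≡⟨ ^-+ u k k ⟩
    u ^ k ++ u ^ k      ≡⟨ cong₂ _++_ (sym w≡uᵏ) (sym w≡uᵏ) ⟩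
    w ++ w              ≡⟨ cong₂ _++_ w≡ab w≡ab ⟩
    (a ++ b) ++ a ++ b  ≡⟨ solve (words s) ⟩
    a ++ (b ++ a) ++ b  ≡⟨ cong (λ t → a ++ t ++ b) (sym p≡ba) ⟩
    a ++ p ++ b         ∎)
  where open ≡-Reasoning
... | u′ , u′~u , pp = prim (u′ , k , k≥2 , pp-unique pp (pp-power u′ k) (begin
    length p       ≡⟨ sym (conj-length (a , b , w≡ab , p≡ba)) ⟩
    length w       ≡⟨ cong length w≡uᵏ ⟩
    length (u ^ k) ≡⟨ length-^ u k ⟩
    k * length u   ≡⟨ cong (k *_) (sym (conj-length u′~u)) ⟩
    k * length u′  ≡⟨ sym (length-^ u′ k) ⟩
    length (u′ ^ k) ∎))
  where open ≡-Reasoning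

word-≟ : DecidableEquality (Word s)
word-≟ = ≡-dec Fin._≟_

search-below : {P : ℕ → Set} → (∀ i → Dec (P i)) → (b : ℕ) → Dec (Σ ℕ λ i → (i < b) × P i)
search-below P? zero = no λ { (i , () , _) }
search-below {P = P} P? (suc b) with P? b | search-below P? b
... | yes pb | _                  = yes (b , ≤-refl , pb)
... | no _   | yes (i , i<b , pi) = yes (i , m<n⇒m<1+n i<b , pi)
... | no ¬pb | no ¬below          = no none
  where
  none : ¬ (Σ ℕ λ i → (i < suc b) × P i)
  none (i , i<1+b , pi) with m<1+n⇒m<n∨m≡n i<1+b
  ... | inj₁ i<b  = ¬below (i , i<b , pi)
  ... | inj₂ refl = ¬pb pi

exponent-bound : (u : Word s) (k : ℕ) → 0 < length u → k ≤ length (u ^ k)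
exponent-bound u k 0<u = subst (k ≤_) (sym (length-^ u k)) (m≤m*n k (length u) {{>-nonZero 0<u}})

base-bound : (u : Word s) (k : ℕ) → 1 ≤ k → length u ≤ length (u ^ k)
base-bound u (suc k) _ = subst (length u ≤_) (sym (length-++ u)) (m≤m+n (length u) _)

take-++ : (u r : Word s) → take (length u) (u ++ r) ≡ u
take-++ []      r = refl
take-++ (x ∷ u) r = cong (x ∷_) (take-++ u r)

drop-++ : (u r : Word s) → drop (length u) (u ++ r) ≡ r
drop-++ []      r = refl
drop-++ (x ∷ u) r = drop-++ u r

nonempty-power : (u : Word s) (k : ℕ) → 0 < length (u ^ k) → 0 < length u
nonempty-power []      k 0<uᵏ = subst (λ w → 0 < length w) ([]-^ k) 0<uᵏ
nonempty-power (_ ∷ _) k _    = s≤s z≤n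

-- Being a proper power is decidable: the base is a prefix of w and both its
-- length and the exponent are bounded by |w|.
properPower? : (w : Word s) → 0 < length w → Dec (ProperPower w)
properPower? w 0<w = map′ found complete
  (search-below (λ d → search-below (λ k → (2 ≤? k) ×-dec word-≟ w (take d w ^ k)) (suc (length w)))
                (suc (length w)))
  where
  SmallWitness : Set
  SmallWitness = Σ ℕ λ d → (d < suc (length w)) × Σ ℕ λ k → (k < suc (length w)) × ((2 ≤ k) × (w ≡ take d w ^ k))
  found : SmallWitness → ProperPower w
  found (d , _ , k , _ , k≥2 , w≡) = take d w , k , k≥2 , w≡
  complete : ProperPower w → SmallWitness
  complete (u , suc k , k≥2 , w≡uᵏ) = length u , s≤s |u|≤|w| , suc k , s≤s k≤|w| , k≥2 ,
    trans w≡uᵏ (cong (_^ suc k) (sym (trans (cong (take (length u)) w≡uᵏ) (take-++ u (u ^ k)))))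
    where
    |w|≡ : length (u ^ suc k) ≡ length w
    |w|≡ = cong length (sym w≡uᵏ)
    |u|≤|w| : length u ≤ length w
    |u|≤|w| = subst (length u ≤_) |w|≡ (base-bound u (suc k) (s≤s z≤n))
    k≤|w| : suc k ≤ length w
    k≤|w| = subst (suc k ≤_) |w|≡ (exponent-bound u (suc k) (nonempty-power u (suc k) (subst (0 <_) (sym |w|≡) 0<w)))

primitive-root : (w : Word s) → 0 < length w →
  Σ (Word s) λ r → Σ ℕ λ e → Primitive r × (e ≥ 1) × (w ≡ r ^ e)
primitive-root w = go (length w) w ≤-refl
  where
  go : ∀ {s} (f : ℕ) (w : Word s) → length w ≤ f → 0 < length w →
    Σ (Word s) λ r → Σ ℕ λ e → Primitive r × (e ≥ 1) × (w ≡ r ^ e)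
  go f w le 0<w with properPower? w 0<w
  ... | no prim = w , 1 , prim , s≤s z≤n , sym (++-identityʳ w)
  go zero    w le 0<w | yes _ = ⊥-elim (<-irrefl refl (<-≤-trans 0<w le))
  go (suc f) w le 0<w | yes (u , suc zero , s≤s () , _)
  go (suc f) w le 0<w | yes (u , suc (suc k) , _ , w≡uᵏ) with go f u (s≤s⁻¹ (≤-trans |u|<|w| le)) 0<u
    where
    0<u : 0 < length u
    0<u = nonempty-power u (suc (suc k)) (subst (λ z → 0 < length z) w≡uᵏ 0<w)
    |u|<|w| : length u < length w
    |u|<|w| = subst (length u <_) (trans (sym (length-++ u)) (cong length (sym w≡uᵏ)))
                    (m<m+n (length u) (<-≤-trans 0<u (base-bound u (suc k) (s≤s z≤n))))
  ... | r , e , prim , e≥1 , u≡rᵉ = r , e * suc (suc k) , prim , *-mono-≤ e≥1 (s≤s z≤n) ,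
    trans w≡uᵏ (trans (cong (_^ suc (suc k)) u≡rᵉ) (sym (^-* r e (suc (suc k)))))

lex-irrefl : {u : Word s} → ¬ (u <lex u)
lex-irrefl (here a<a) = Fin.<-irrefl refl a<a
lex-irrefl (there r)  = lex-irrefl r

lex-trans : {u v w : Word s} → u <lex v → v <lex w → u <lex w
lex-trans []<∷       (here _)   = []<∷
lex-trans []<∷       (there _)  = []<∷
lex-trans (here a<b) (here b<c) = here (Fin.<-trans a<b b<c)
lex-trans (here a<b) (there _)  = here a<b
lex-trans (there _)  (here b<c) = here b<c
lex-trans (there r)  (there r′) = there (lex-trans r r′)

lex-trichotomy : (u v : Word s) → (u <lex v) ⊎ (u ≡ v) ⊎ (v <lex u)
lex-trichotomy []      []      = inj₂ (inj₁ refl)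
lex-trichotomy []      (_ ∷ _) = inj₁ []<∷
lex-trichotomy (_ ∷ _) []      = inj₂ (inj₂ []<∷)
lex-trichotomy (a ∷ u) (b ∷ v) with Fin.<-cmp a b
... | tri< a<b _ _ = inj₁ (here a<b)
... | tri> _ _ b<a = inj₂ (inj₂ (here b<a))
... | tri≈ _ refl _ with lex-trichotomy u v
...   | inj₁ u<v         = inj₁ (there u<v)
...   | inj₂ (inj₁ refl) = inj₂ (inj₁ refl)
...   | inj₂ (inj₂ v<u)  = inj₂ (inj₂ (there v<u))

-- Conjugate Lyndon words are equal: each is smaller than the other otherwise.
lyndon-conj-equal : {p q : Word s} → Lyndon p → Lyndon q → Conj p q → p ≡ q
lyndon-conj-equal _ _ ([] , b , p≡ , q≡) = trans p≡ (sym (trans q≡ (++-identityʳ b)))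
lyndon-conj-equal _ _ (x ∷ a , [] , p≡ , q≡) = trans p≡ (trans (++-identityʳ (x ∷ a)) (sym q≡))
lyndon-conj-equal {p = p} {q} (_ , p-min) (_ , q-min) (x ∷ a , y ∷ b , p≡ , q≡) =
  ⊥-elim (lex-irrefl (lex-trans p<q q<p))
  where
  p<q : p <lex q
  p<q = subst (p <lex_) (sym q≡) (p-min (x ∷ a) (y ∷ b) (λ ()) (λ ()) p≡)
  q<p : q <lex p
  q<p = subst (q <lex_) (sym p≡) (q-min (y ∷ b) (x ∷ a) (λ ()) (λ ()) q≡)

module _ {A : Set} (_<_ : A → A → Set) (irreflexive : ∀ {x} → ¬ (x < x))
         (transitive : ∀ {x y z} → x < y → y < z → x < z)
         (trichotomous : ∀ x y → (x < y) ⊎ (x ≡ y) ⊎ (y < x)) where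

  minimal : (x : A) (xs : List A) → Σ A λ m → (m ∈ x ∷ xs) × (∀ {y} → y ∈ x ∷ xs → ¬ (y < m))
  minimal x [] = x , here refl , λ { (here refl) → irreflexive }
  minimal x (z ∷ zs) with minimal z zs
  ... | m , m∈ , m-min with trichotomous x m
  ...   | inj₁ x<m = x , here refl , λ
    { (here refl) → irreflexive
    ; (there y∈)  → λ y<x → m-min y∈ (transitive y<x x<m) }
  ...   | inj₂ (inj₁ refl) = m , here refl , λ
    { (here refl) → irreflexive
    ; (there y∈)  → m-min y∈ }
  ...   | inj₂ (inj₂ m<x) = m , there m∈ , λ
    { (here refl) → λ x<m → irreflexive (transitive x<m m<x)
    ; (there y∈)  → m-min y∈ }

splits : Word s → List (Word s × Word s)
splits w = applyUpTo (λ i → take i w , drop i w) (suc (length w))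

splits-complete : (a b : Word s) → (a , b) ∈ splits (a ++ b)
splits-complete a b = subst (_∈ splits (a ++ b)) (cong₂ _,_ (take-++ a b) (drop-++ a b))
  (∈-applyUpTo⁺ (λ i → take i (a ++ b) , drop i (a ++ b)) (s≤s (length-++-≤ˡ a)))

splits-sound : {a b w : Word s} → (a , b) ∈ splits w → w ≡ a ++ b
splits-sound {w = w} ab∈ with ∈-applyUpTo⁻ (λ i → take i w , drop i w) ab∈
... | i , _ , refl = sym (take++drop≡id i w)

swap-join : Word s × Word s → Word s
swap-join (a , b) = b ++ a

rotations : Word s → List (Word s)
rotations v = map swap-join (splits v)

rotations-sound : {c v : Word s} → c ∈ rotations v → Conj c v
rotations-sound c∈ with ∈-map⁻ swap-join c∈
... | (a , b) , ab∈ , refl = b , a , refl , splits-sound ab∈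

rotations-complete : {c v : Word s} → Conj c v → c ∈ rotations v
rotations-complete {v = v} (a , b , refl , v≡ba) =
  ∈-map⁺ swap-join (subst (λ w → (b , a) ∈ splits w) (sym v≡ba) (splits-complete b a))

-- A primitive word has a Lyndon conjugate: its lexicographically least rotation.
lyndon-conjugate : {r : Word s} → Primitive r → Σ (Word s) λ p → Lyndon p × Conj p r
lyndon-conjugate {r = r} prim with minimal _<lex_ lex-irrefl lex-trans lex-trichotomy r (rotations r)
... | c , c∈ , c-min = c , (c-primitive , c-least) , c~r
  where
  conj-of-member : ∀ {d} → d ∈ r ∷ rotations r → Conj d r
  conj-of-member (here refl) = conj-refl r
  conj-of-member (there d∈)  = rotations-sound d∈
  c~r : Conj c r
  c~r = conj-of-member c∈
  c-primitive : Primitive c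
  c-primitive = conj-primitive prim c~r
  c-least : ∀ x y → x ≢ [] → y ≢ [] → c ≡ x ++ y → c <lex (y ++ x)
  c-least x y x≢[] y≢[] c≡xy with lex-trichotomy c (y ++ x)
  ... | inj₁ c<yx        = c<yx
  ... | inj₂ (inj₁ c≡yx) = ⊥-elim (primitive-split c-primitive c≡xy x≢[] y≢[] (trans (sym c≡xy) c≡yx))
  ... | inj₂ (inj₂ yx<c) = ⊥-elim (c-min (there (rotations-complete (conj-trans (y , x , refl , c≡xy) c~r))) yx<c)

-- Condition (1): distinct Lyndon words have no long common power factors

pp-self : (p : Word s) → PrefixOfPower p p
pp-self p = 1 , [] , refl

pq-prefix : {p q w : Word s} → 0 < length p → PrefixOfPower p w → PrefixOfPower q w →
  length p + length q ≤ length w → Prefix (p ++ q) w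
pq-prefix {p = p} {q} {w} 0<p ppw qqw le with pp-compare (pp-self p) ppw (m+n≤o⇒m≤o (length p) le)
... | w₁ , w≡pw₁ with pp-compare ppq ppw₁ |q|≤|w₁|
  where
  ppq : PrefixOfPower p q
  ppq = pp-prefix (pp-compare (pp-self q) qqw (m+n≤o⇒n≤o (length p) le)) ppw
  ppw₁ : PrefixOfPower p w₁
  ppw₁ = pp-drop 0<p (subst (PrefixOfPower p) w≡pw₁ ppw)
  |q|≤|w₁| : length q ≤ length w₁
  |q|≤|w₁| = +-cancelˡ-≤ (length p) _ _ (subst (length p + length q ≤_) (trans (cong length w≡pw₁) (length-++ p)) le)
... | d , w₁≡qd = d , trans w≡pw₁ (trans (cong (p ++_) w₁≡qd) (sym (++-assoc p q d)))

prefix-powers-commute : {p q w : Word s} → 0 < length p → 0 < length q →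
  PrefixOfPower p w → PrefixOfPower q w → length p + length q ≤ length w → p ++ q ≡ q ++ p
prefix-powers-commute {p = p} {q} {w} 0<p 0<q ppw qqw le =
  prefix-equal (prefix-shorter pq≤w qp≤w (≤-reflexive same-length)) (≤-reflexive (sym same-length))
  where
  same-length : length (p ++ q) ≡ length (q ++ p)
  same-length = conj-length (p , q , refl , refl)
  pq≤w : Prefix (p ++ q) w
  pq≤w = pq-prefix 0<p ppw qqw le
  qp≤w : Prefix (q ++ p) w
  qp≤w = pq-prefix 0<q qqw ppw (subst (_≤ length w) (+-comm (length p) (length q)) le)

lyndon-common-factor : {p q w : Word s} {l m : ℕ} → Lyndon p → Lyndon q →
  length p + length q ≤ length w → Factor w (p ^ l) → Factor w (q ^ m) → p ≡ q
lyndon-common-factor {p = p} {q} {w} {l} {m} lyn-p lyn-q le (A , B , pˡ≡) (C , D , qᵐ≡)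
  with factor-of-power p l A w B pˡ≡ | factor-of-power q m C w D qᵐ≡
... | p′ , p′~p , pp′w | q′ , q′~q , qq′w =
  lyndon-conj-equal lyn-p lyn-q (conj-trans (conj-sym p′~p) (subst (λ z → Conj z q) q′≡p′ q′~q))
  where
  prim-p′ : Primitive p′
  prim-p′ = conj-primitive (proj₁ lyn-p) p′~p
  prim-q′ : Primitive q′
  prim-q′ = conj-primitive (proj₁ lyn-q) q′~q
  q′≡p′ : q′ ≡ p′
  q′≡p′ = primitive-commuting-equal prim-p′ prim-q′
    (prefix-powers-commute (primitive-nonempty prim-p′) (primitive-nonempty prim-q′) pp′w qq′w
      (subst₂ (λ a b → a + b ≤ length w) (sym (conj-length p′~p)) (sym (conj-length q′~q)) le))

member-length : {p : Word s} {ws : List (Word s)} → p ∈ ws → length p ≤ sum (map length ws)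
member-length {p = p} {ws = _ ∷ ws} (here refl) = m≤m+n (length p) (sum (map length ws))
member-length {ws = w ∷ _} (there p∈) = ≤-trans (member-length p∈) (m≤n+m _ (length w))

no-common-factors : {P : List (Word s)} (n : ℕ) → All Lyndon P →
  sum (map length P) + sum (map length P) ≤ n → NoCommonFactors n P
no-common-factors {P = P} n lyndon 2S≤n p q p∈ q∈ p≢q l m (w , |w|≡n , w⊑pˡ , w⊑qᵐ) =
  p≢q (lyndon-common-factor {l = l} {m = m} (All.lookup lyndon p∈) (All.lookup lyndon q∈) |p|+|q|≤|w| w⊑pˡ w⊑qᵐ)
  where
  |p|+|q|≤|w| : length p + length q ≤ length w
  |p|+|q|≤|w| = subst (length p + length q ≤_) (sym |w|≡n)
                      (≤-trans (+-mono-≤ (member-length p∈) (member-length q∈)) 2S≤n)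

-- Condition (3): long factors of words of a bounded language contain high powers

conj-power-factor : {u p : Word s} (c : ℕ) → Conj u p → Factor (p ^ c) (u ^ suc c)
conj-power-factor {u = u} {p} c (f , g , u≡fg , p≡gf) = f , g , (begin
  u ^ suc c                       ≡⟨ cong (_^ suc c) u≡fg ⟩
  (f ++ g) ++ (f ++ g) ^ c        ≡⟨ ++-assoc f g _ ⟩
  f ++ g ++ (f ++ g) ^ c          ≡⟨ cong (f ++_) (sym (power-shift g f c)) ⟩
  f ++ (g ++ f) ^ c ++ g          ≡⟨ cong (λ t → f ++ t ^ c ++ g) (sym p≡gf) ⟩
  f ++ p ^ c ++ g                 ∎)
  where open ≡-Reasoning

record LyndonRoot (v : Word s) : Set where
  field
    root     : Word s
    exponent : ℕ
    positive : exponent ≥ 1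
    v≡       : v ≡ root ^ exponent
    lyndon   : Word s
    isLyndon : Lyndon lyndon
    conj     : Conj root lyndon

lyndon-root : (v : Word s) → 0 < length v → LyndonRoot v
lyndon-root v 0<v with primitive-root v 0<v
... | r , e , prim , e≥1 , v≡rᵉ with lyndon-conjugate prim
...   | p , lyn , p~r = record
  { root = r ; exponent = e ; positive = e≥1 ; v≡ = v≡rᵉ
  ; lyndon = p ; isLyndon = lyn ; conj = conj-sym p~r }

long-factor-contains-power : {v : Word s} (R : LyndonRoot v) (i c : ℕ) {y : Word s} →
  Factor y (v ^ i) → suc c * length v ≤ length y → Factor (LyndonRoot.lyndon R ^ c) y
long-factor-contains-power {v = v} R i c {y} (A , B , vⁱ≡) le
  with factor-of-power root (exponent * i) A y B (trans (^-* root exponent i) (trans (cong (_^ i) (sym v≡)) vⁱ≡))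
  where open LyndonRoot R
... | r′ , r′~r , ppy = factor-trans (conj-power-factor c (conj-trans r′~r conj))
                                     (prefix⇒factor (pp-compare (pp-power r′ (suc c)) ppy long))
  where
  open LyndonRoot R
  open ≤-Reasoning
  long : length (r′ ^ suc c) ≤ length y
  long = begin
    length (r′ ^ suc c)   ≡⟨ length-^ r′ (suc c) ⟩
    suc c * length r′     ≡⟨ cong (suc c *_) (conj-length r′~r) ⟩
    suc c * length root   ≤⟨ *-monoʳ-≤ (suc c) (subst (length root ≤_) (cong length (sym v≡)) (base-bound root exponent positive)) ⟩
    suc c * length v      ≤⟨ le ⟩
    length y              ∎

straddle : (A B x : Word s) (T K : ℕ) → Factor x (A ++ B) → T + K ≤ length x →
  (Σ (Word s) λ y → Factor y x × Factor y A × (T ≤ length y)) ⊎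
  (Σ (Word s) λ y → Factor y x × Factor y B × (K ≤ length y))
straddle A B x T K (α , β , AB≡) le with levi A B α (x ++ β) AB≡
... | inj₁ (e , α≡Ae , B≡exβ) = inj₂ (x , factor-refl x , (e , β , B≡exβ) , m+n≤o⇒n≤o T le)
... | inj₂ (e , A≡αe , xβ≡eB) with levi x β e B xβ≡eB
...   | inj₁ (e′ , e≡xe′ , _) =
  inj₁ (x , factor-refl x , (α , e′ , trans A≡αe (cong (α ++_) e≡xe′)) , m+n≤o⇒m≤o T le)
...   | inj₂ (e′ , x≡ee′ , B≡e′β) with T ≤? length e
...     | yes T≤e = inj₁ (e , ([] , e′ , x≡ee′) , suffix⇒factor A≡αe , T≤e)
...     | no  T≰e = inj₂ (e′ , suffix⇒factor x≡ee′ , ([] , β , B≡e′β) , K≤e′)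
  where
  K≤e′ : K ≤ length e′
  K≤e′ = +-cancelˡ-≤ T _ _ (≤-trans (subst (T + K ≤_) (trans (cong length x≡ee′) (length-++ e)) le)
                                    (+-monoˡ-≤ (length e′) (<⇒≤ (≰⇒> T≰e))))

lyndonRoots : List (Word s) → List (Word s)
lyndonRoots []              = []
lyndonRoots ([] ∷ vs)       = lyndonRoots vs
lyndonRoots ((a ∷ v) ∷ vs)  = LyndonRoot.lyndon (lyndon-root (a ∷ v) (s≤s z≤n)) ∷ lyndonRoots vs

lyndonRoots-lyndon : (vs : List (Word s)) → All Lyndon (lyndonRoots vs)
lyndonRoots-lyndon []             = []
lyndonRoots-lyndon ([] ∷ vs)      = lyndonRoots-lyndon vs
lyndonRoots-lyndon ((a ∷ v) ∷ vs) = LyndonRoot.isLyndon (lyndon-root (a ∷ v) (s≤s z≤n)) ∷ lyndonRoots-lyndon vs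

lyndonRoots-tail : (v : Word s) (vs : List (Word s)) {p : Word s} → p ∈ lyndonRoots vs → p ∈ lyndonRoots (v ∷ vs)
lyndonRoots-tail []      vs p∈ = p∈
lyndonRoots-tail (a ∷ v) vs p∈ = there p∈

-- Factors of a word in v₁* ⋯ vₘ* of at least this length contain a power pⁿ⁺¹ of some Lyndon root p.
threshold : ℕ → List (Word s) → ℕ
threshold n []       = 1
threshold n (v ∷ vs) = suc (suc (suc n) * length v) + threshold n vs

-- A long factor y of vⁱ contains pⁿ⁺¹ for the Lyndon root p of v; for v = [] there is
-- no such factor, which is why the threshold adds 1 to (n+2)|v|.
power-block-factor : (n : ℕ) (v : Word s) (vs : List (Word s)) (i : ℕ) {y : Word s} →
  Factor y (v ^ i) → suc (suc (suc n) * length v) ≤ length y →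
  Σ (Word s) λ p → (p ∈ lyndonRoots (v ∷ vs)) × Factor (p ^ suc n) y
power-block-factor n []      vs i y⊑ le =
  ⊥-elim (<-irrefl refl (<-≤-trans (<-≤-trans (s≤s z≤n) le) (subst (λ z → _ ≤ length z) ([]-^ i) (factor-length y⊑))))
power-block-factor n (a ∷ v) vs i y⊑ le =
  LyndonRoot.lyndon R , here refl , long-factor-contains-power R i (suc n) y⊑ (<⇒≤ le)
  where
  R : LyndonRoot (a ∷ v)
  R = lyndon-root (a ∷ v) (s≤s z≤n)

long-factor-in-star-product : (n : ℕ) (vs : List (Word s)) {w x : Word s} → InStarProduct vs w →
  Factor x w → threshold n vs ≤ length x → Σ (Word s) λ p → (p ∈ lyndonRoots vs) × Factor (p ^ suc n) x
long-factor-in-star-product n [] {x = x} w≡[] x⊑w le =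
  ⊥-elim (<-irrefl refl (<-≤-trans le (subst (λ z → length x ≤ length z) w≡[] (factor-length x⊑w))))
long-factor-in-star-product n (v ∷ vs) {x = x} (i , w′ , w≡ , w′∈) x⊑w le
  with straddle (v ^ i) w′ x _ (threshold n vs) (subst (Factor x) w≡ x⊑w) le
... | inj₁ (y , y⊑x , y⊑vⁱ , long) with power-block-factor n v vs i y⊑vⁱ long
...   | p , p∈ , pⁿ⁺¹⊑y = p , p∈ , factor-trans pⁿ⁺¹⊑y y⊑x
long-factor-in-star-product n (v ∷ vs) {x = x} (i , w′ , w≡ , w′∈) x⊑w le
    | inj₂ (y , y⊑x , y⊑w′ , long) with long-factor-in-star-product n vs w′∈ y⊑w′ long
...   | p , p∈ , pⁿ⁺¹⊑y = p , lyndonRoots-tail v vs p∈ , factor-trans pⁿ⁺¹⊑y y⊑x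

-- Condition (2), automata part: pumping between two long runs of p

two-windows : (p u x₁ y₁ x₂ y₂ : Word s) {c₁ c₂ : ℕ} (a₁ d₁ b₂ d₂ : ℕ) →
  u ≡ x₁ ++ p ^ c₁ ++ y₁ → u ≡ x₂ ++ p ^ c₂ ++ y₂ → a₁ + d₁ ≤ c₁ → b₂ + d₂ ≤ c₂ →
  length x₁ ≤ length x₂ → a₁ + d₁ ≤ b₂ →
  Σ (Word s) λ Y → (x₂ ++ p ^ b₂ ≡ (x₁ ++ p ^ a₁) ++ p ^ d₁ ++ Y) ×
                   (u ≡ (x₁ ++ p ^ a₁) ++ p ^ d₁ ++ Y ++ p ^ d₂ ++ p ^ (c₂ ∸ (b₂ + d₂)) ++ y₂)
two-windows {s} p u x₁ y₁ x₂ y₂ {c₁} {c₂} a₁ d₁ b₂ d₂ u≡₁ u≡₂ fits₁ fits₂ x₁≤x₂ ordered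
  with prefix-shorter (p ^ (c₁ ∸ (a₁ + d₁)) ++ y₁ ,
                       trans (run-split p x₁ y₁ a₁ d₁ u≡₁ fits₁) (sym (++-assoc (x₁ ++ p ^ a₁) (p ^ d₁) _)))
                      (p ^ d₂ ++ p ^ (c₂ ∸ (b₂ + d₂)) ++ y₂ , run-split p x₂ y₂ b₂ d₂ u≡₂ fits₂)
                      first-shorter
  where
  first-shorter : length ((x₁ ++ p ^ a₁) ++ p ^ d₁) ≤ length (x₂ ++ p ^ b₂)
  first-shorter = subst (_≤ length (x₂ ++ p ^ b₂))
    (cong length (trans (cong (x₁ ++_) (^-+ p a₁ d₁)) (sym (++-assoc x₁ _ _))))
    (length-power-mono x₁ x₂ p x₁≤x₂ ordered)
... | Y , S≡ = Y , trans S≡ (++-assoc (x₁ ++ p ^ a₁) (p ^ d₁) Y) , (begin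
  u                                                            ≡⟨ run-split p x₂ y₂ b₂ d₂ u≡₂ fits₂ ⟩
  (x₂ ++ p ^ b₂) ++ p ^ d₂ ++ R                                 ≡⟨ cong (_++ p ^ d₂ ++ R) S≡ ⟩
  (((x₁ ++ p ^ a₁) ++ p ^ d₁) ++ Y) ++ p ^ d₂ ++ R              ≡⟨ solve (words s) ⟩
  (x₁ ++ p ^ a₁) ++ p ^ d₁ ++ Y ++ p ^ d₂ ++ R                  ∎)
  where
  open ≡-Reasoning
  R : Word s
  R = p ^ (c₂ ∸ (b₂ + d₂)) ++ y₂

module Pumping {s : ℕ} (D : DFA s) where
  open DFA D using (nStates; start)

  run-++ : ∀ q (a b : Word s) → run D q (a ++ b) ≡ run D (run D q a) b
  run-++ q []      b = refl
  run-++ q (x ∷ a) b = run-++ (DFA.δ D q x) a b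

  Loop : Fin nStates → Word s → Set
  Loop q w = run D q w ≡ q

  loop-skip : ∀ {q} w → Loop q w → ∀ v → run D q (w ++ v) ≡ run D q v
  loop-skip {q} w loop v = trans (run-++ q w v) (cong (λ q′ → run D q′ v) loop)

  loop-^ : ∀ {q} w → Loop q w → ∀ i → Loop q (w ^ i)
  loop-^ w loop zero    = refl
  loop-^ w loop (suc i) = trans (loop-skip w loop (w ^ i)) (loop-^ w loop i)

  -- Pigeonhole: among the nStates + 1 states reached from q by p⁰, …, pᴺ two coincide.
  repeated-state : (q : Fin nStates) (p : Word s) →
    Σ ℕ λ a → Σ ℕ λ d → (d ≥ 1) × (a + d ≤ nStates) × Loop (run D q (p ^ a)) (p ^ d)
  repeated-state q p with Fin.pigeonhole (n<1+n nStates) (λ t → run D q (p ^ toℕ t))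
  ... | i , j , i<j , same = a , b ∸ a , m<n⇒0<n∸m i<j , a+d≤N , (begin
    run D (run D q (p ^ a)) (p ^ (b ∸ a))  ≡⟨ sym (run-++ q (p ^ a) _) ⟩
    run D q (p ^ a ++ p ^ (b ∸ a))         ≡⟨ cong (run D q) (sym (^-+ p a (b ∸ a))) ⟩
    run D q (p ^ (a + (b ∸ a)))            ≡⟨ cong (λ k → run D q (p ^ k)) (m+[n∸m]≡n (<⇒≤ i<j)) ⟩
    run D q (p ^ b)                        ≡⟨ sym same ⟩
    run D q (p ^ a)                        ∎)
    where
    open ≡-Reasoning
    a b : ℕ
    a = toℕ i
    b = toℕ j
    a+d≤N : a + (b ∸ a) ≤ nStates
    a+d≤N = subst (_≤ nStates) (sym (m+[n∸m]≡n (<⇒≤ i<j))) (s≤s⁻¹ (Fin.toℕ<n j))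

  two-loops : (X A Y B Z : Word s) → Loop (run D start X) A → Loop (run D start (X ++ Y)) B →
    run D start (X ++ A ++ Y ++ B ++ Z) ≡ run D start (X ++ Y ++ Z)
  two-loops X A Y B Z loopA loopB = begin
    run D start (X ++ A ++ Y ++ B ++ Z)          ≡⟨ run-++ start X _ ⟩
    run D (run D start X) (A ++ Y ++ B ++ Z)     ≡⟨ loop-skip A loopA _ ⟩
    run D (run D start X) (Y ++ B ++ Z)          ≡⟨ sym (run-++ start X _) ⟩
    run D start (X ++ Y ++ B ++ Z)               ≡⟨ cong (run D start) (sym (++-assoc X Y _)) ⟩
    run D start ((X ++ Y) ++ B ++ Z)             ≡⟨ run-++ start (X ++ Y) _ ⟩
    run D (run D start (X ++ Y)) (B ++ Z)        ≡⟨ loop-skip B loopB Z ⟩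
    run D (run D start (X ++ Y)) Z               ≡⟨ sym (run-++ start (X ++ Y) Z) ⟩
    run D start ((X ++ Y) ++ Z)                  ≡⟨ cong (run D start) (++-assoc X Y Z) ⟩
    run D start (X ++ Y ++ Z)                    ∎
    where open ≡-Reasoning

  Pumpable : Word s → Word s → Set
  Pumpable p Y = Σ (Word s) λ X → Σ (Word s) λ Z → Σ ℕ λ m →
    (m ≥ 1) × (∀ (i j : ℕ) → Accepts D (X ++ ((p ^ m) ^ i) ++ Y ++ ((p ^ m) ^ j) ++ Z))

  -- Two loops pᵈ¹ and pᵈ² in an accepted word can be pumped simultaneously with period d₁d₂.
  pump-loops : (p X Y Z : Word s) (d₁ d₂ : ℕ) → d₁ ≥ 1 → d₂ ≥ 1 →
    Accepts D (X ++ p ^ d₁ ++ Y ++ p ^ d₂ ++ Z) →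
    Loop (run D start X) (p ^ d₁) → Loop (run D start (X ++ p ^ d₁ ++ Y)) (p ^ d₂) → Pumpable p Y
  pump-loops p X Y Z d₁ d₂ d₁≥1 d₂≥1 acc loop₁ loop₂ = X , Z , d₁ * d₂ , *-mono-≤ d₁≥1 d₂≥1 , pumped
    where
    loop₂′ : Loop (run D start (X ++ Y)) (p ^ d₂)
    loop₂′ = subst (λ q → Loop q (p ^ d₂)) (begin
      run D start (X ++ p ^ d₁ ++ Y)     ≡⟨ run-++ start X _ ⟩
      run D (run D start X) (p ^ d₁ ++ Y) ≡⟨ loop-skip (p ^ d₁) loop₁ Y ⟩
      run D (run D start X) Y            ≡⟨ sym (run-++ start X Y) ⟩
      run D start (X ++ Y)               ∎) loop₂
      where open ≡-Reasoning
    P : Word s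
    P = p ^ (d₁ * d₂)
    -- P is a power of both pᵈ¹ and pᵈ², so it loops at both states
    period₁ : Loop (run D start X) P
    period₁ = subst (Loop (run D start X)) (sym (^-* p d₁ d₂)) (loop-^ (p ^ d₁) loop₁ d₂)
    period₂ : Loop (run D start (X ++ Y)) P
    period₂ = subst (Loop (run D start (X ++ Y))) (trans (sym (^-* p d₂ d₁)) (cong (p ^_) (*-comm d₂ d₁)))
                    (loop-^ (p ^ d₂) loop₂′ d₁)
    pumped : ∀ i j → Accepts D (X ++ (P ^ i) ++ Y ++ (P ^ j) ++ Z)
    pumped i j = trans (cong (DFA.final D) (begin
      run D start (X ++ P ^ i ++ Y ++ P ^ j ++ Z)     ≡⟨ two-loops X (P ^ i) Y (P ^ j) Z (loop-^ P period₁ i) (loop-^ P period₂ j) ⟩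
      run D start (X ++ Y ++ Z)                       ≡⟨ sym (two-loops X (p ^ d₁) Y (p ^ d₂) Z loop₁ loop₂′) ⟩
      run D start (X ++ p ^ d₁ ++ Y ++ p ^ d₂ ++ Z)   ∎)) acc
      where open ≡-Reasoning

  -- An accepted word containing a run pᶜ¹ (c₁ ≥ N) and, starting later, a run pᶜ² (c₂ ≥ 2N)
  -- yields a pumpable pattern X (pᵐ)* Y (pᵐ)* Z: a loop in the first N copies of p of the
  -- first run, and a loop in the last N copies of p of the second run.
  two-runs-pump : (p u x₁ y₁ x₂ y₂ : Word s) (c₁ c₂ : ℕ) → Accepts D u →
    u ≡ x₁ ++ p ^ c₁ ++ y₁ → u ≡ x₂ ++ p ^ c₂ ++ y₂ → nStates ≤ c₁ → nStates + nStates ≤ c₂ →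
    length x₁ ≤ length x₂ →
    Σ (Word s) λ Y → Pumpable p Y × Σ ℕ λ a → Σ ℕ λ b → u ≡ x₁ ++ p ^ a ++ Y ++ p ^ b ++ y₂
  two-runs-pump p u x₁ y₁ x₂ y₂ c₁ c₂ acc u≡₁ u≡₂ N≤c₁ 2N≤c₂ x₁≤x₂
    with repeated-state (run D start x₁) p | repeated-state (run D start (x₂ ++ p ^ (c₂ ∸ nStates))) p
  ... | a₁ , d₁ , d₁≥1 , a₁+d₁≤N , loop₁ | a₂ , d₂ , d₂≥1 , a₂+d₂≤N , loop₂ =
    from-windows (two-windows p u x₁ y₁ x₂ y₂ a₁ d₁ b₂ d₂ u≡₁ u≡₂ (≤-trans a₁+d₁≤N N≤c₁) second-fits
                              x₁≤x₂ ordered)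
    where
    N b₂ e₂ : ℕ
    N  = nStates
    b₂ = c₂ ∸ N + a₂
    e₂ = c₂ ∸ (b₂ + d₂)
    second-fits : b₂ + d₂ ≤ c₂
    second-fits = begin
      c₂ ∸ N + a₂ + d₂     ≡⟨ +-assoc (c₂ ∸ N) a₂ d₂ ⟩
      c₂ ∸ N + (a₂ + d₂)   ≤⟨ +-monoʳ-≤ (c₂ ∸ N) a₂+d₂≤N ⟩
      c₂ ∸ N + N           ≡⟨ m∸n+n≡m (≤-trans (m≤m+n N N) 2N≤c₂) ⟩
      c₂                   ∎
      where open ≤-Reasoning
    ordered : a₁ + d₁ ≤ b₂
    ordered = ≤-trans a₁+d₁≤N (≤-trans (m+n≤o⇒m≤o∸n N 2N≤c₂) (m≤m+n _ a₂))
    loop₁′ : Loop (run D start (x₁ ++ p ^ a₁)) (p ^ d₁)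
    loop₁′ = subst (λ q → Loop q (p ^ d₁)) (sym (run-++ start x₁ (p ^ a₁))) loop₁
    loop₂′ : Loop (run D start (x₂ ++ p ^ b₂)) (p ^ d₂)
    loop₂′ = subst (λ q → Loop q (p ^ d₂)) (sym (begin
      run D start (x₂ ++ p ^ b₂)                         ≡⟨ cong (λ t → run D start (x₂ ++ t)) (^-+ p (c₂ ∸ N) a₂) ⟩
      run D start (x₂ ++ p ^ (c₂ ∸ N) ++ p ^ a₂)         ≡⟨ cong (run D start) (sym (++-assoc x₂ _ _)) ⟩
      run D start ((x₂ ++ p ^ (c₂ ∸ N)) ++ p ^ a₂)       ≡⟨ run-++ start (x₂ ++ p ^ (c₂ ∸ N)) (p ^ a₂) ⟩
      run D (run D start (x₂ ++ p ^ (c₂ ∸ N))) (p ^ a₂)  ∎)) loop₂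
      where open ≡-Reasoning
    from-windows :
      (Σ (Word s) λ Y → (x₂ ++ p ^ b₂ ≡ (x₁ ++ p ^ a₁) ++ p ^ d₁ ++ Y) ×
                        (u ≡ (x₁ ++ p ^ a₁) ++ p ^ d₁ ++ Y ++ p ^ d₂ ++ p ^ e₂ ++ y₂)) →
      Σ (Word s) λ Y → Pumpable p Y × Σ ℕ λ a → Σ ℕ λ b → u ≡ x₁ ++ p ^ a ++ Y ++ p ^ b ++ y₂
    from-windows (Y , S≡ , u≡) =
      Y , pump-loops p (x₁ ++ p ^ a₁) Y (p ^ e₂ ++ y₂) d₁ d₂ d₁≥1 d₂≥1 (subst (Accepts D) u≡ acc) loop₁′
                     (subst (λ t → Loop (run D start t) (p ^ d₂)) S≡ loop₂′) ,
      a₁ + d₁ , d₂ + e₂ , (begin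
        u                                                        ≡⟨ u≡ ⟩
        (x₁ ++ p ^ a₁) ++ p ^ d₁ ++ Y ++ p ^ d₂ ++ p ^ e₂ ++ y₂   ≡⟨ solve (words s) ⟩
        x₁ ++ (p ^ a₁ ++ p ^ d₁) ++ Y ++ (p ^ d₂ ++ p ^ e₂) ++ y₂ ≡⟨ cong₂ (λ P Q → x₁ ++ P ++ Y ++ Q ++ y₂) (sym (^-+ p a₁ d₁)) (sym (^-+ p d₂ e₂)) ⟩
        x₁ ++ p ^ (a₁ + d₁) ++ Y ++ p ^ (d₂ + e₂) ++ y₂          ∎)
      where open ≡-Reasoning

-- Condition (2), combinatorial part: maximal occurrences

occurrences-after : Word s × Word s → List (Occurrence {s})
occurrences-after (x , r) = map (x ,_) (splits r)

occurrences : Word s → List (Occurrence {s})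
occurrences w = concatMap occurrences-after (splits w)

occurrences-complete : {w : Word s} (o : Occurrence {s}) → IsOcc w o → o ∈ occurrences w
occurrences-complete (x , v , y) refl =
  ∈-concat⁺′ (∈-map⁺ (x ,_) (splits-complete v y)) (∈-map⁺ occurrences-after (splits-complete x (v ++ y)))

module _ {A : Set} {Q : A → Set} (xs : List A) (listed : ∀ a → Q a → a ∈ xs) (Q? : ∀ a → Dec (Q a)) where

  listed-all? : {R : A → Set} → (∀ a → Dec (R a)) → Dec (∀ a → Q a → R a)
  listed-all? R? = map′ (λ all a qa → All.lookup all (listed a qa) qa) (λ f → All.tabulate (λ {a} _ → f a))
                        (All.all? (λ a → Q? a →-dec R? a) xs)

  at-most-one-or-two : DecidableEquality A →
    (∀ a b → Q a → Q b → a ≡ b) ⊎ (Σ A λ a → Σ A λ b → Q a × Q b × a ≢ b)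
  at-most-one-or-two _≟_ with Any.any? (λ a → Any.any? (λ b → Q? a ×-dec Q? b ×-dec ¬? (a ≟ b)) xs) xs
  ... | yes two with Any.satisfied two
  ...   | a , inner with Any.satisfied inner
  ...     | b , qa , qb , a≢b = inj₂ (a , b , qa , qb , a≢b)
  at-most-one-or-two _≟_ | no none = inj₁ unique
    where
    unique : ∀ a b → Q a → Q b → a ≡ b
    unique a b qa qb with a ≟ b
    ... | yes a≡b = a≡b
    ... | no  a≢b = ⊥-elim (none (lose (listed a qa) (lose (listed b qb) (qa , qb , a≢b))))

occurrence-≟ : DecidableEquality (Occurrence {s})
occurrence-≟ = Product.≡-dec word-≟ (Product.≡-dec word-≟ word-≟)

-- Membership in p^{≥n} is decidable for nonempty p: the exponent is at most |w|.
powAtLeast? : {p : Word s} → 0 < length p → (n : ℕ) (w : Word s) → Dec (PowAtLeast p n w)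
powAtLeast? {p = p} 0<p n w = map′ (λ { (i , _ , n≤i , w≡) → i , n≤i , w≡ }) small
  (search-below (λ i → (n ≤? i) ×-dec word-≟ w (p ^ i)) (suc (length w)))
  where
  small : PowAtLeast p n w → Σ ℕ λ i → (i < suc (length w)) × ((n ≤ i) × (w ≡ p ^ i))
  small (i , n≤i , w≡) = i , s≤s (subst (i ≤_) (cong length (sym w≡)) (exponent-bound p i 0<p)) , n≤i , w≡

mocc? : {M : Language s} → (∀ w → Dec (M w)) → (u : Word s) (o : Occurrence {s}) → Dec (IsMOcc M u o)
mocc? M? u (x , v , y) = word-≟ u (x ++ v ++ y) ×-dec M? v

contained? : (o o′ : Occurrence {s}) → Dec (ContainedIn o o′)
contained? (x , _ , y) (x′ , _ , y′) = (length x′ ≤? length x) ×-dec (length y′ ≤? length y)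

-- Maximality is decidable, since the occurrences in u can be listed.
maximal? : {M : Language s} → (∀ w → Dec (M w)) → (u : Word s) (o : Occurrence {s}) → Dec (IsMaximalMOcc M u o)
maximal? M? u o = mocc? M? u o ×-dec
  listed-all? (occurrences u) (λ o′ m → occurrences-complete o′ (proj₁ m)) (mocc? M? u)
              (λ o′ → contained? o o′ →-dec occurrence-≟ o′ o)

maximal-occurrences : {M : Language s} → (∀ w → Dec (M w)) → (u : Word s) →
  AtMostOneMaximal M u ⊎
  (Σ (Occurrence {s}) λ o₁ → Σ (Occurrence {s}) λ o₂ → IsMaximalMOcc M u o₁ × IsMaximalMOcc M u o₂ × o₁ ≢ o₂)
maximal-occurrences M? u =
  at-most-one-or-two (occurrences u) (λ o m → occurrences-complete o (proj₁ (proj₁ m))) (maximal? M? u) occurrence-≟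

maximal-ordered : {M : Language s} {u x₁ v₁ y₁ x₂ v₂ y₂ : Word s} →
  IsMaximalMOcc M u (x₁ , v₁ , y₁) → IsMaximalMOcc M u (x₂ , v₂ , y₂) → (x₁ , v₁ , y₁) ≢ (x₂ , v₂ , y₂) →
  length x₁ ≤ length x₂ → length y₂ < length y₁
maximal-ordered (occ₁ , _) (_ , max₂) o₁≢o₂ x₁≤x₂ = ≰⇒> (λ y₁≤y₂ → o₁≢o₂ (max₂ _ occ₁ (x₁≤x₂ , y₁≤y₂)))

length-occ : (x v y : Word s) → length (x ++ v ++ y) ≡ length x + (length v + length y)
length-occ x v y = trans (length-++ x) (cong (length x +_) (length-++ v))

no-covering-run : {p u x₁ v₁ y₁ x₂ v₂ y₂ : Word s} {n : ℕ} →
  IsMaximalMOcc (PowAtLeast p n) u (x₁ , v₁ , y₁) → IsMaximalMOcc (PowAtLeast p n) u (x₂ , v₂ , y₂) →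
  (x₁ , v₁ , y₁) ≢ (x₂ , v₂ , y₂) → length x₁ ≤ length x₂ → length y₂ < length y₁ →
  (big : ℕ) → u ≢ x₁ ++ p ^ big ++ y₂
no-covering-run {s} {p = p} {u} {x₁} {v₁} {y₁} {y₂ = y₂} {n}
                ((u≡₁ , c₁ , n≤c₁ , v₁≡) , max₁) (_ , max₂) o₁≢o₂ x₁≤x₂ y₂<y₁ big u≡ =
  o₁≢o₂ (trans (sym (max₁ o occ (≤-refl , <⇒≤ y₂<y₁))) (max₂ o occ (x₁≤x₂ , ≤-refl)))
  where
  o : Occurrence {s}
  o = x₁ , p ^ big , y₂
  lengths : (c : ℕ) (y : Word s) → length (x₁ ++ p ^ c ++ y) ≡ length x₁ + (c * length p + length y)
  lengths c y = trans (length-occ x₁ (p ^ c) y) (cong (λ z → length x₁ + (z + length y)) (length-^ p c))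
  same-length : c₁ * length p + length y₁ ≡ big * length p + length y₂
  same-length = +-cancelˡ-≡ (length x₁) _ _ (trans (sym (lengths c₁ y₁))
    (trans (cong length (trans (sym (subst (λ v → u ≡ x₁ ++ v ++ y₁) v₁≡ u≡₁)) u≡)) (lengths big y₂)))
  c₁<big : c₁ < big
  c₁<big = ≰⇒> λ big≤c₁ → <-irrefl (sym same-length) (+-mono-≤-< (*-monoˡ-≤ (length p) big≤c₁) y₂<y₁)
  occ : IsMOcc (PowAtLeast p n) u o
  occ = u≡ , big , ≤-trans n≤c₁ (<⇒≤ c₁<big) , refl

-- Two distinct maximal p^{≥n}-occurrences (n ≥ 2N) in a word accepted by D yield a pumping subset:
-- the pattern X (pᵐ)* Y (pᵐ)* Z of two-runs-pump, where Y does not commute with p since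
-- otherwise one run of p would cover both occurrences.
pump-ordered : (D : DFA s) (n : ℕ) → DFA.nStates D + DFA.nStates D ≤ n → {p u : Word s} → Primitive p →
  Accepts D u → {o₁ o₂ : Occurrence {s}} →
  IsMaximalMOcc (PowAtLeast p n) u o₁ → IsMaximalMOcc (PowAtLeast p n) u o₂ → o₁ ≢ o₂ →
  length (proj₁ o₁) ≤ length (proj₁ o₂) → HasPumpingSubset (Accepts D) p
pump-ordered {s} D n 2N≤n {p} {u} prim acc {x₁ , v₁ , y₁} {x₂ , v₂ , y₂}
             max₁@((u≡₁ , c₁ , n≤c₁ , v₁≡) , _) max₂@((u≡₂ , c₂ , n≤c₂ , v₂≡) , _) o₁≢o₂ x₁≤x₂ =
  from-pattern (Pumping.two-runs-pump D p u x₁ y₁ x₂ y₂ c₁ c₂ acc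
                  (subst (λ v → u ≡ x₁ ++ v ++ y₁) v₁≡ u≡₁) (subst (λ v → u ≡ x₂ ++ v ++ y₂) v₂≡ u≡₂)
                  (≤-trans (m≤m+n _ _) (≤-trans 2N≤n n≤c₁)) (≤-trans 2N≤n n≤c₂) x₁≤x₂)
  where
  from-pattern : (Σ (Word s) λ Y → Pumping.Pumpable D p Y × Σ ℕ λ a → Σ ℕ λ b → u ≡ x₁ ++ p ^ a ++ Y ++ p ^ b ++ y₂) →
    HasPumpingSubset (Accepts D) p
  from-pattern (Y , (X , Z , m , m≥1 , pumped) , a , b , u≡) = X , Y , Z , m , m≥1 , noncommuting , pumped
    where
    noncommuting : p ++ Y ≢ Y ++ p
    noncommuting pY≡Yp with commutes-with-primitive prim pY≡Yp
    ... | t , Y≡pᵗ =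
      no-covering-run max₁ max₂ o₁≢o₂ x₁≤x₂ (maximal-ordered max₁ max₂ o₁≢o₂ x₁≤x₂) (a + (t + b)) (begin
      u                                         ≡⟨ u≡ ⟩
      x₁ ++ p ^ a ++ Y ++ p ^ b ++ y₂           ≡⟨ cong (λ z → x₁ ++ p ^ a ++ z ++ p ^ b ++ y₂) Y≡pᵗ ⟩
      x₁ ++ p ^ a ++ p ^ t ++ p ^ b ++ y₂       ≡⟨ solve (words s) ⟩
      x₁ ++ (p ^ a ++ p ^ t ++ p ^ b) ++ y₂     ≡⟨ cong (λ z → x₁ ++ z ++ y₂) (sym (power-split₃ p a t b)) ⟩
      x₁ ++ p ^ (a + (t + b)) ++ y₂             ∎)
      where open ≡-Reasoning

condition2-automaton : (D : DFA s) (n : ℕ) → DFA.nStates D + DFA.nStates D ≤ n → {p u : Word s} →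
  Primitive p → Accepts D u → AtMostOneMaximal (PowAtLeast p n) u ⊎ HasPumpingSubset (Accepts D) p
condition2-automaton D n 2N≤n {p} {u} prim acc with maximal-occurrences (powAtLeast? (primitive-nonempty prim) n) u
... | inj₁ unique = inj₁ unique
... | inj₂ (o₁ , o₂ , max₁ , max₂ , o₁≢o₂) with ≤-total (length (proj₁ o₁)) (length (proj₁ o₂))
...   | inj₁ x₁≤x₂ = inj₂ (pump-ordered D n 2N≤n prim acc max₁ max₂ o₁≢o₂ x₁≤x₂)
...   | inj₂ x₂≤x₁ = inj₂ (pump-ordered D n 2N≤n prim acc max₂ max₁ (≢-sym o₁≢o₂) x₂≤x₁)

pumping-subset-mono : {L L′ : Language s} {p : Word s} → (∀ w → L w → L′ w) → HasPumpingSubset L p → HasPumpingSubset L′ p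
pumping-subset-mono L⊆L′ (x , y , z , m , m≥1 , noncommuting , pumped) =
  x , y , z , m , m≥1 , noncommuting , λ i j → L⊆L′ _ (pumped i j)

-- The theorem: take for P the Lyndon roots of the words v₁, …, vₘ with L ⊆ v₁* ⋯ vₘ*,
-- n = 2N + 2Σ|p| for an automaton of N states recognising L, and k = threshold n (v₁ … vₘ).
lemma8 : (s : ℕ) (L : Language s) → Regular L → Bounded L →
    Σ ℕ λ n → Σ ℕ λ k → Σ (List (Word s)) λ P →
      All Lyndon P × NoCommonFactors n P × Condition2 L n P × Condition3 L n k P
lemma8 s L (D , recognises) (vs , bounded) =
  n , threshold n vs , P , lyndonRoots-lyndon vs ,
  no-common-factors n (lyndonRoots-lyndon vs) (m≤n+m (S + S) (N + N)) , condition2 , condition3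
  where
  P : List (Word s)
  P = lyndonRoots vs
  N S n : ℕ
  N = DFA.nStates D
  S = sum (map length P)
  n = (N + N) + (S + S)
  condition2 : Condition2 L n P
  condition2 u p Lu p∈ = Sum.map₂ (pumping-subset-mono (λ w → proj₂ (recognises w)))
    (condition2-automaton D n (m≤m+n (N + N) (S + S)) (proj₁ (All.lookup (lyndonRoots-lyndon vs) p∈))
                          (proj₁ (recognises u) Lu))
  condition3 : Condition3 L n (threshold n vs) P
  condition3 u x Lu x⊑u = long-factor-in-star-product n vs (bounded u Lu) x⊑u
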